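{- Let $k\ge2$. For every integer $N\ge1$, \[F(N,k)=f_0(N,k)+k\,F\!\left(\left\lceil\frac{N}{k}\right\rceil-1,\;k\right).\]
   Context: Fix an integer $k\ge 2$. Let $T_k$ be the infinite rooted $k$-ary tree (every vertex has exactly $k$ children) with one additional self-loop at the root, so every vertex has degree $k+1$. Chip-firing: a vertex with at least $k+1$ chips may fire, sending one chip along each incident edge (a non-root vertex sends one chip to its parent and one to each of its $k$ children; the root sends one chip to each of its $k$ children and one chip to itself along the self-loop). Starting with $N\ge0$ chips at the root and none elsewhere, vertices fire until no vertex can fire; this terminates, and the number of times each vertex fires does not depend on the order of firings. $f_0(N,k)$ denotes the number of root fires and $F(N,k)$ the total number of fires summed over all vertices (both are $0$ for $N=0$). -}

module Defs where

open import Data.Nat using (ℕ; zero; suc; _+_; _∸_; _≤_; _<_)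
open import Data.Nat.DivMod using (_/_)
open import Data.Fin using (Fin)
import Data.Fin.Properties as FinP
open import Data.List using (List; []; _∷_; length)
import Data.List.Properties as ListP
open import Data.Product using (Σ; _×_)
open import Relation.Nullary using (yes; no)
open import Relation.Binary.PropositionalEquality using (_≡_)

-- Vertices of the infinite rooted k-ary tree T_k, encoded by the path from
-- the vertex up to the root: [] is the root, (i ∷ v) is the i-th child of v.
Vertex : ℕ → Set
Vertex k = List (Fin k)

_≟V_ : ∀ {k} (v w : Vertex k) → Relation.Nullary.Dec (v ≡ w)
_≟V_ = ListP.≡-dec FinP._≟_

Config : ℕ → Set
Config k = Vertex k → ℕ

initial : (k N : ℕ) → Config k
initial k N []      = N
initial k N (_ ∷ _) = 0

-- Number of edges of T_k (with the self-loop at the root) joining v to w,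
-- i.e. number of chips w receives when v fires.
edges : ∀ {k} → Vertex k → Vertex k → ℕ
edges [] [] = 1
edges [] (i ∷ w) with w ≟V [] 
... | yes _ = 1
... | no  _ = 0
edges (i ∷ v) [] with v ≟V []
... | yes _ = 1
... | no  _ = 0
edges (i ∷ v) (j ∷ w) with w ≟V (i ∷ v) | v ≟V (j ∷ w)
... | yes _ | _     = 1
... | no  _ | yes _ = 1
... | no  _ | no  _ = 0

-- Firing vertex v: v loses k+1 chips (its degree) and sends one chip along
-- each incident edge (the root receives one back through its self-loop).
fire : (k : ℕ) → Vertex k → Config k → Config k
fire k v c w with w ≟V v
... | yes _ = (c w + edges v w) ∸ suc k
... | no  _ = c w + edges v w

data Run (k : ℕ) : Config k → List (Vertex k) → Config k → Set where
  done : ∀ {c} → Run k c [] c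
  step : ∀ {c c' v vs} → suc k ≤ c v → Run k (fire k v c) vs c' → Run k c (v ∷ vs) c'

Stable : (k : ℕ) → Config k → Set
Stable k c = ∀ v → c v < suc k

Stabilizing : (k N : ℕ) → List (Vertex k) → Set
Stabilizing k N vs = Σ (Config k) (λ c' → Run k (initial k N) vs c' × Stable k c')

rootFires : ∀ {k} → List (Vertex k) → ℕ
rootFires [] = 0
rootFires ([] ∷ vs) = suc (rootFires vs)
rootFires ((_ ∷ _) ∷ vs) = rootFires vs

-- Ceiling division ⌈N / k⌉ (k > 0; value 0 for k = 0, never used).
ceilDiv : ℕ → ℕ → ℕ
ceilDiv N zero = 0
ceilDiv N (suc j) = (N + j) / suc j

{-# OPTIONS --safe #-}
module Submission where

-- Let u be the firing counts of a stabilizing run from N chips, u₀ its count at the root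
-- and uᵢ its count at the i-th child of the root; let M = ⌈N/k⌉ − 1, so kM < N ≤ k(M + 1),
-- and let m be the root count of a stabilizing run from M chips.  The subtree below each
-- child of the root is a copy of T_k (w ↦ w ∷ʳ i, as vertices list their path upwards)
-- in which the edge to the root replaces the self-loop.  By the least action principle
-- (a legal run never fires a vertex more often than a firing multiset that stabilizes):
-- firing the root M + m times and a copy of the M-run in every subtree stabilizes N
-- chips, so every subtree fires at most as the M-run; and if M + uᵢ ≤ u₀, the part of u
-- inside the i-th subtree stabilizes M chips, so that subtree fires at least as the M-run.
-- Stability at the root gives N + Σᵢ uᵢ ≤ k(u₀ + 1), so kM < N yields one child with
-- M + uᵢ ≤ u₀; hence m ≤ uᵢ, so M + uⱼ ≤ M + m ≤ u₀ for every child j, and u is u₀ root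
-- fires plus k copies of the M-run.

open import Defs
open import Data.Nat using (ℕ; zero; suc; _+_; _*_; _∸_; _≤_; _<_; z≤n; s≤s; _<?_)
open import Data.Nat.Properties
open import Data.Nat.DivMod using (_/_; _%_; m≡m%n+[m/n]*n; m%n<n)
open import Data.Nat.Tactic.RingSolver using (solve-∀)
open import Algebra.Properties.CommutativeSemigroup +-commutativeSemigroup
  using (interchange; x∙yz≈y∙xz; x∙yz≈xz∙y; xy∙z≈xz∙y)
open import Algebra.Properties.CommutativeMonoid.Sum +-0-commutativeMonoid
  using (sum; sum-syntax; sum-cong-≗; sum-replicate-zero; ∑-distrib-+)
open import Data.Fin using (Fin; zero; suc)
import Data.Fin.Properties as Finₚ
open import Data.List
  using ( List; []; _∷_; length; _++_; _∷ʳ_; replicate; map; mapMaybe; concatMap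
        ; tabulate; allFin; initLast; _∷ʳ′_)
open import Data.List.Properties using (∷ʳ-injective; length-removeAt′)
open import Data.List.Membership.Propositional using (_∈_; _─_)
open import Data.List.Relation.Unary.Any using (here; there; index)
open import Data.Maybe using (Maybe; just; nothing; maybe′)
open import Data.Product using (∃; _×_; _,_; proj₁; proj₂; map₂)
open import Function using (_∘_)
open import Relation.Nullary using (Dec; yes; no; ¬_; contradiction)
open import Relation.Binary.PropositionalEquality

m+n*[o+p]≡m+n*p+n*o : ∀ m n o p → m + n * (o + p) ≡ m + n * p + n * o
m+n*[o+p]≡m+n*p+n*o = solve-∀

⟦_⟧ : {P : Set} → Dec P → ℕ
⟦ yes _ ⟧ = 1
⟦ no  _ ⟧ = 0

⟦⟧-yes : {P : Set} (p : Dec P) → P → ⟦ p ⟧ ≡ 1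
⟦⟧-yes (yes _) _  = refl
⟦⟧-yes (no ¬p) p  = contradiction p ¬p

⟦⟧-no : {P : Set} (p : Dec P) → ¬ P → ⟦ p ⟧ ≡ 0
⟦⟧-no (yes p) ¬p = contradiction p ¬p
⟦⟧-no (no _)  _  = refl

⟦⟧-cong : {P Q : Set} (p : Dec P) (q : Dec Q) → (P → Q) → (Q → P) → ⟦ p ⟧ ≡ ⟦ q ⟧
⟦⟧-cong p (yes q) _   Q⇒P = ⟦⟧-yes p (Q⇒P q)
⟦⟧-cong p (no ¬q) P⇒Q _   = ⟦⟧-no p (¬q ∘ P⇒Q)

∑-const : ∀ n c → ∑[ i < n ] c ≡ n * c
∑-const zero    c = refl
∑-const (suc n) c = cong (c +_) (∑-const n c)

∑-δ : ∀ {n} (f : Fin n → ℕ) j → (∀ i → i ≢ j → f i ≡ 0) → ∑[ i < n ] f i ≡ f j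
∑-δ {suc n} f zero f≡0 =
  trans (cong (f zero +_) (trans (sum-cong-≗ (λ i → f≡0 (suc i) λ ())) (sum-replicate-zero n)))
        (+-identityʳ _)
∑-δ f (suc j) f≡0 =
  cong₂ _+_ (f≡0 zero λ ()) (∑-δ (f ∘ suc) j (λ i i≢j → f≡0 (suc i) (i≢j ∘ Finₚ.suc-injective)))

∑-<⇒∃-< : ∀ {n} (f g : Fin n → ℕ) → ∑[ i < n ] f i < ∑[ i < n ] g i → ∃ λ i → f i < g i
∑-<⇒∃-< {zero}  f g ()
∑-<⇒∃-< {suc n} f g ∑f<∑g with f zero <? g zero
... | yes f₀<g₀ = zero , f₀<g₀
... | no  f₀≮g₀ = let (i , fᵢ<gᵢ) = ∑-<⇒∃-< (f ∘ suc) (g ∘ suc) tail< in suc i , fᵢ<gᵢ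
  where
    tail< : ∑[ i < n ] f (suc i) < ∑[ i < n ] g (suc i)
    tail< = +-cancelˡ-< (g zero) _ _ (≤-<-trans (+-monoˡ-≤ _ (≮⇒≥ f₀≮g₀)) ∑f<∑g)

variable
  A B : Set

sumOver : (A → ℕ) → List A → ℕ
sumOver f []       = 0
sumOver f (x ∷ xs) = f x + sumOver f xs

sumOver-cong : ∀ {f g : A → ℕ} xs → (∀ x → f x ≡ g x) → sumOver f xs ≡ sumOver g xs
sumOver-cong []       _   = refl
sumOver-cong (x ∷ xs) f≗g = cong₂ _+_ (f≗g x) (sumOver-cong xs f≗g)

sumOver-zero : ∀ {f : A → ℕ} xs → (∀ x → f x ≡ 0) → sumOver f xs ≡ 0
sumOver-zero []       _   = refl
sumOver-zero (x ∷ xs) f≗0 = cong₂ _+_ (f≗0 x) (sumOver-zero xs f≗0)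

sumOver-+ : ∀ (f g : A → ℕ) xs → sumOver (λ x → f x + g x) xs ≡ sumOver f xs + sumOver g xs
sumOver-+ f g []       = refl
sumOver-+ f g (x ∷ xs) = trans (cong (f x + g x +_) (sumOver-+ f g xs)) (interchange (f x) (g x) _ _)

sumOver-*ˡ : ∀ c (f : A → ℕ) xs → sumOver (λ x → c * f x) xs ≡ c * sumOver f xs
sumOver-*ˡ c f []       = sym (*-zeroʳ c)
sumOver-*ˡ c f (x ∷ xs) = trans (cong (c * f x +_) (sumOver-*ˡ c f xs)) (sym (*-distribˡ-+ c (f x) _))

sumOver-linear : ∀ (f : A → ℕ) c g xs →
                 sumOver (λ x → f x + c * g x) xs ≡ sumOver f xs + c * sumOver g xs
sumOver-linear f c g xs = trans (sumOver-+ f _ xs) (cong (sumOver f xs +_) (sumOver-*ˡ c g xs))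

sumOver-++ : ∀ (f : A → ℕ) xs ys → sumOver f (xs ++ ys) ≡ sumOver f xs + sumOver f ys
sumOver-++ f []       ys = refl
sumOver-++ f (x ∷ xs) ys = trans (cong (f x +_) (sumOver-++ f xs ys)) (sym (+-assoc (f x) _ _))

sumOver-replicate : ∀ (f : A → ℕ) n x → sumOver f (replicate n x) ≡ n * f x
sumOver-replicate f zero    x = refl
sumOver-replicate f (suc n) x = cong (f x +_) (sumOver-replicate f n x)

sumOver-map : ∀ (f : B → ℕ) (g : A → B) xs → sumOver f (map g xs) ≡ sumOver (f ∘ g) xs
sumOver-map f g []       = refl
sumOver-map f g (x ∷ xs) = cong (f (g x) +_) (sumOver-map f g xs)

sumOver-concatMap : ∀ (f : B → ℕ) (g : A → List B) xs →
                    sumOver f (concatMap g xs) ≡ sumOver (sumOver f ∘ g) xs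
sumOver-concatMap f g []       = refl
sumOver-concatMap f g (x ∷ xs) =
  trans (sumOver-++ f (g x) _) (cong (sumOver f (g x) +_) (sumOver-concatMap f g xs))

sumOver-mapMaybe : ∀ (f : B → ℕ) (g : A → Maybe B) xs →
                   sumOver f (mapMaybe g xs) ≡ sumOver (maybe′ f 0 ∘ g) xs
sumOver-mapMaybe f g [] = refl
sumOver-mapMaybe f g (x ∷ xs) with g x
... | nothing = sumOver-mapMaybe f g xs
... | just y  = cong (f y +_) (sumOver-mapMaybe f g xs)

sumOver-tabulate : ∀ {n} (f : A → ℕ) (g : Fin n → A) → sumOver f (tabulate g) ≡ ∑[ i < n ] f (g i)
sumOver-tabulate {n = zero}  f g = refl
sumOver-tabulate {n = suc n} f g = cong (f (g zero) +_) (sumOver-tabulate f (g ∘ suc))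

sumOver-∑ : ∀ {n} (g : A → Fin n → ℕ) xs →
            sumOver (λ x → ∑[ i < n ] g x i) xs ≡ ∑[ i < n ] sumOver (λ x → g x i) xs
sumOver-∑ {n = n} g []       = sym (sum-replicate-zero n)
sumOver-∑     g (x ∷ xs) = trans (cong (sum (g x) +_) (sumOver-∑ g xs)) (sym (∑-distrib-+ (g x) _))

sumOver-─ : ∀ (f : A → ℕ) {x} xs (x∈xs : x ∈ xs) → sumOver f xs ≡ f x + sumOver f (xs ─ x∈xs)
sumOver-─ f (y ∷ xs) (here refl) = refl
sumOver-─ f {x} (y ∷ xs) (there x∈xs) =
  trans (cong (f y +_) (sumOver-─ f xs x∈xs)) (x∙yz≈y∙xz (f y) (f x) _)

sumOver-1≡length : ∀ (xs : List A) → sumOver (λ _ → 1) xs ≡ length xs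
sumOver-1≡length []       = refl
sumOver-1≡length (x ∷ xs) = cong suc (sumOver-1≡length xs)

module _ {k : ℕ} where

  δ : Vertex k → Vertex k → ℕ
  δ v w = ⟦ v ≟V w ⟧

  count : List (Vertex k) → Vertex k → ℕ
  count L w = sumOver (λ v → δ v w) L

  inflow : List (Vertex k) → Vertex k → ℕ
  inflow L w = sumOver (λ v → edges v w) L

  δ-refl : ∀ v → δ v v ≡ 1
  δ-refl v = ⟦⟧-yes (v ≟V v) refl

  δ-sym : ∀ v w → δ v w ≡ δ w v
  δ-sym v w = ⟦⟧-cong (v ≟V w) (w ≟V v) sym sym

  δ-∷ʳ : ∀ v w i → δ (v ∷ʳ i) (w ∷ʳ i) ≡ δ v w
  δ-∷ʳ v w i = ⟦⟧-cong _ _ (proj₁ ∘ ∷ʳ-injective v w) (cong (_∷ʳ i))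

  δ-∷ʳ-≢ : ∀ v w {i j} → i ≢ j → δ (v ∷ʳ i) (w ∷ʳ j) ≡ 0
  δ-∷ʳ-≢ v w i≢j = ⟦⟧-no _ (i≢j ∘ proj₂ ∘ ∷ʳ-injective v w)

  δ-∷ʳ-[] : ∀ v i → δ (v ∷ʳ i) [] ≡ 0
  δ-∷ʳ-[] []      i = refl
  δ-∷ʳ-[] (_ ∷ _) i = refl

  δ-[]-∷ʳ : ∀ w i → δ [] (w ∷ʳ i) ≡ 0
  δ-[]-∷ʳ []      i = refl
  δ-[]-∷ʳ (_ ∷ _) i = refl

  rootFires≡count : ∀ (vs : List (Vertex k)) → rootFires vs ≡ count vs []
  rootFires≡count []            = refl
  rootFires≡count ([] ∷ vs)     = cong suc (rootFires≡count vs)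
  rootFires≡count ((_ ∷ _) ∷ vs) = rootFires≡count vs

  initial≡δ* : ∀ N (w : Vertex k) → initial k N w ≡ δ w [] * N
  initial≡δ* N []      = sym (+-identityʳ N)
  initial≡δ* N (_ ∷ _) = refl

  count≢0⇒∈ : ∀ L {v} → count L v ≢ 0 → v ∈ L
  count≢0⇒∈ []      count≢0 = contradiction refl count≢0
  count≢0⇒∈ (x ∷ L) {v} count≢0 with x ≟V v
  ... | yes refl = here refl
  ... | no  _    = there (count≢0⇒∈ L count≢0)

  count-≗⇒length-≡ : ∀ L₁ L₂ → (∀ w → count L₁ w ≡ count L₂ w) → length L₁ ≡ length L₂
  count-≗⇒length-≡ []       []       _    = refl
  count-≗⇒length-≡ []       (y ∷ L₂) same =
    contradiction (trans (same y) (cong (_+ count L₂ y) (δ-refl y))) λ ()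
  count-≗⇒length-≡ (x ∷ L₁) L₂       same = begin
      suc (length L₁)           ≡⟨ cong suc (count-≗⇒length-≡ L₁ (L₂ ─ x∈L₂) same′) ⟩
      suc (length (L₂ ─ x∈L₂))  ≡⟨ length-removeAt′ L₂ (index x∈L₂) ⟨
      length L₂                 ∎
    where
      open ≡-Reasoning
      x∈L₂ : x ∈ L₂
      x∈L₂ = count≢0⇒∈ L₂ λ eq →
        1+n≢0 (trans (cong (_+ count L₁ x) (sym (δ-refl x))) (trans (same x) eq))
      same′ : ∀ w → count L₁ w ≡ count (L₂ ─ x∈L₂) w
      same′ w = +-cancelˡ-≡ (δ x w) _ _ (trans (same w) (sumOver-─ _ L₂ x∈L₂))

  fire-balance : ∀ {c : Config k} {v} → suc k ≤ c v →
                 ∀ w → fire k v c w + suc k * δ w v ≡ c w + edges v w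
  fire-balance {c} {v} v-fires w with w ≟V v
  ... | yes refl = trans (cong (c v + edges v v ∸ suc k +_) (*-identityʳ (suc k)))
                         (m∸n+n≡m (≤-trans v-fires (m≤m+n (c v) (edges v v))))
  ... | no  _    = trans (cong (c w + edges v w +_) (*-zeroʳ k)) (+-identityʳ _)

  chips-after-run : ∀ {c c′ vs} → Run k c vs c′ → ∀ w → c′ w + suc k * count vs w ≡ c w + inflow vs w
  chips-after-run {c} done w = cong (c w +_) (*-zeroʳ (suc k))
  chips-after-run {c} {c′} (step {v = v} {vs = vs} v-fires run) w = begin
      c′ w + suc k * (δ v w + count vs w)           ≡⟨ m+n*[o+p]≡m+n*p+n*o (c′ w) (suc k) _ _ ⟩
      c′ w + suc k * count vs w + suc k * δ v w     ≡⟨ cong₂ _+_ (chips-after-run run w) (cong (suc k *_) (δ-sym v w)) ⟩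
      fire k v c w + inflow vs w + suc k * δ w v    ≡⟨ xy∙z≈xz∙y (fire k v c w) _ _ ⟩
      fire k v c w + suc k * δ w v + inflow vs w    ≡⟨ cong (_+ inflow vs w) (fire-balance v-fires w) ⟩
      c w + edges v w + inflow vs w                 ≡⟨ +-assoc (c w) _ _ ⟩
      c w + (edges v w + inflow vs w)               ∎
    where open ≡-Reasoning

  -- c minus the effect of firing every vertex of L (legally or not) is stable,
  -- stated without subtraction.
  Stabilizes : Config k → List (Vertex k) → Set
  Stabilizes c L = ∀ w → c w + inflow L w ≤ k + suc k * count L w

  stable-run⇒Stabilizes : ∀ {c c′ vs} → Run k c vs c′ → Stable k c′ → Stabilizes c vs
  stable-run⇒Stabilizes {c} {c′} {vs} run stable w = begin
      c w + inflow vs w             ≡⟨ chips-after-run run w ⟨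
      c′ w + suc k * count vs w     ≤⟨ +-monoˡ-≤ _ (≤-pred (stable w)) ⟩
      k + suc k * count vs w        ∎
    where open ≤-Reasoning

  fireable⇒∈ : ∀ {c v} L → Stabilizes c L → suc k ≤ c v → v ∈ L
  fireable⇒∈ {c} {v} L stab v-fires = count≢0⇒∈ L λ count≡0 → 1+n≰n (begin
      suc k                   ≤⟨ v-fires ⟩
      c v                     ≤⟨ m≤m+n (c v) _ ⟩
      c v + inflow L v        ≤⟨ stab v ⟩
      k + suc k * count L v   ≡⟨ cong (λ n → k + suc k * n) count≡0 ⟩
      k + suc k * 0           ≡⟨ cong (k +_) (*-zeroʳ (suc k)) ⟩
      k + 0                   ≡⟨ +-identityʳ k ⟩
      k                       ∎)
    where open ≤-Reasoning

  Stabilizes-fire : ∀ {c L v} (v∈L : v ∈ L) → suc k ≤ c v → Stabilizes c L →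
                    Stabilizes (fire k v c) (L ─ v∈L)
  Stabilizes-fire {c} {L} {v} v∈L v-fires stab w = +-cancelʳ-≤ (suc k * δ w v) _ _ (begin
      fire k v c w + inflow L′ w + suc k * δ w v  ≡⟨ xy∙z≈xz∙y (fire k v c w) _ _ ⟩
      fire k v c w + suc k * δ w v + inflow L′ w  ≡⟨ cong (_+ inflow L′ w) (fire-balance v-fires w) ⟩
      c w + edges v w + inflow L′ w               ≡⟨ +-assoc (c w) _ _ ⟩
      c w + (edges v w + inflow L′ w)             ≡⟨ cong (c w +_) (sumOver-─ _ L v∈L) ⟨
      c w + inflow L w                            ≤⟨ stab w ⟩
      k + suc k * count L w                       ≡⟨ cong (λ n → k + suc k * n) (sumOver-─ _ L v∈L) ⟩
      k + suc k * (δ v w + count L′ w)            ≡⟨ m+n*[o+p]≡m+n*p+n*o k (suc k) _ _ ⟩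
      k + suc k * count L′ w + suc k * δ v w      ≡⟨ cong (λ d → k + suc k * count L′ w + suc k * d) (δ-sym v w) ⟩
      k + suc k * count L′ w + suc k * δ w v      ∎)
    where
      open ≤-Reasoning
      L′ = L ─ v∈L

  least-action : ∀ {c c′ vs} → Run k c vs c′ → ∀ L → Stabilizes c L → ∀ w → count vs w ≤ count L w
  least-action done _ _ w = z≤n
  least-action (step {v = v} {vs = vs} v-fires run) L stab w = begin
      δ v w + count vs w          ≤⟨ +-monoʳ-≤ (δ v w) (least-action run (L ─ v∈L) (Stabilizes-fire v∈L v-fires stab) w) ⟩
      δ v w + count (L ─ v∈L) w   ≡⟨ sumOver-─ _ L v∈L ⟨
      count L w                   ∎
    where
      open ≤-Reasoning
      v∈L = fireable⇒∈ L stab v-fires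

  edges-∷-[] : ∀ i v → edges (i ∷ v) [] ≡ δ v []
  edges-∷-[] i v with v ≟V []
  ... | yes _ = refl
  ... | no  _ = refl

  edges-[]-∷ : ∀ i w → edges [] (i ∷ w) ≡ δ w []
  edges-[]-∷ i w with w ≟V []
  ... | yes _ = refl
  ... | no  _ = refl

  edges-∷-∷ : ∀ i j v w → edges (i ∷ v) (j ∷ w) ≡ δ w (i ∷ v) + δ v (j ∷ w)
  edges-∷-∷ i j v w with w ≟V (i ∷ v) | v ≟V (j ∷ w)
  ... | yes refl | yes v≡j∷i∷v = contradiction (cong length v≡j∷i∷v) (m≢1+n+m (length v))
  ... | yes _    | no  _       = refl
  ... | no  _    | yes _       = refl
  ... | no  _    | no  _       = refl

  edges-∷ʳ-[] : ∀ v i → edges (v ∷ʳ i) [] ≡ δ v []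
  edges-∷ʳ-[] []      i = refl
  edges-∷ʳ-[] (j ∷ v) i = trans (edges-∷-[] j (v ∷ʳ i)) (δ-∷ʳ-[] v i)

  edges-[]-∷ʳ : ∀ w i → edges [] (w ∷ʳ i) ≡ δ w []
  edges-[]-∷ʳ []      i = refl
  edges-[]-∷ʳ (j ∷ w) i = trans (edges-[]-∷ j (w ∷ʳ i)) (δ-∷ʳ-[] w i)

  edges-∷ʳ-∷ʳ : ∀ v w i → edges (v ∷ʳ i) (w ∷ʳ i) + δ w [] * δ v [] ≡ edges v w
  edges-∷ʳ-∷ʳ []      []      i = refl
  edges-∷ʳ-∷ʳ []      (b ∷ w) i = begin
      edges (i ∷ []) (b ∷ w ∷ʳ i) + 0  ≡⟨ +-identityʳ _ ⟩
      edges (i ∷ []) (b ∷ w ∷ʳ i)      ≡⟨ edges-∷-∷ i b [] (w ∷ʳ i) ⟩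
      δ (w ∷ʳ i) (i ∷ []) + 0          ≡⟨ +-identityʳ _ ⟩
      δ (w ∷ʳ i) ([] ∷ʳ i)             ≡⟨ δ-∷ʳ w [] i ⟩
      δ w []                           ≡⟨ edges-[]-∷ b w ⟨
      edges [] (b ∷ w)                 ∎
    where open ≡-Reasoning
  edges-∷ʳ-∷ʳ (a ∷ v) []      i = begin
      edges (a ∷ v ∷ʳ i) (i ∷ []) + 0  ≡⟨ +-identityʳ _ ⟩
      edges (a ∷ v ∷ʳ i) (i ∷ [])      ≡⟨ edges-∷-∷ a i (v ∷ʳ i) [] ⟩
      δ (v ∷ʳ i) ([] ∷ʳ i)             ≡⟨ δ-∷ʳ v [] i ⟩
      δ v []                           ≡⟨ edges-∷-[] a v ⟨
      edges (a ∷ v) []                 ∎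
    where open ≡-Reasoning
  edges-∷ʳ-∷ʳ (a ∷ v) (b ∷ w) i = begin
      edges (a ∷ v ∷ʳ i) (b ∷ w ∷ʳ i) + 0                ≡⟨ +-identityʳ _ ⟩
      edges (a ∷ v ∷ʳ i) (b ∷ w ∷ʳ i)                    ≡⟨ edges-∷-∷ a b (v ∷ʳ i) (w ∷ʳ i) ⟩
      δ (w ∷ʳ i) (a ∷ v ∷ʳ i) + δ (v ∷ʳ i) (b ∷ w ∷ʳ i)  ≡⟨ cong₂ _+_ (δ-∷ʳ w (a ∷ v) i) (δ-∷ʳ v (b ∷ w) i) ⟩
      δ w (a ∷ v) + δ v (b ∷ w)                          ≡⟨ edges-∷-∷ a b v w ⟨
      edges (a ∷ v) (b ∷ w)                              ∎
    where open ≡-Reasoning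

  edges-∷ʳ-≢ : ∀ v w {i j} → i ≢ j → edges (v ∷ʳ i) (w ∷ʳ j) ≡ 0
  edges-∷ʳ-≢ []      []      i≢j = refl
  edges-∷ʳ-≢ []      (b ∷ w) {i} {j} i≢j =
    trans (edges-∷-∷ i b [] (w ∷ʳ j)) (cong (_+ 0) (δ-∷ʳ-≢ w [] (i≢j ∘ sym)))
  edges-∷ʳ-≢ (a ∷ v) []      {i} {j} i≢j =
    trans (edges-∷-∷ a j (v ∷ʳ i) []) (δ-∷ʳ-≢ v [] i≢j)
  edges-∷ʳ-≢ (a ∷ v) (b ∷ w) {i} {j} i≢j =
    trans (edges-∷-∷ a b (v ∷ʳ i) (w ∷ʳ j)) (cong₂ _+_ (δ-∷ʳ-≢ w (a ∷ v) (i≢j ∘ sym)) (δ-∷ʳ-≢ v (b ∷ w) i≢j))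

  edges-into-root : ∀ v → edges v [] ≡ δ v [] + ∑[ i < k ] δ v (i ∷ [])
  edges-into-root v with initLast v
  ... | []      = cong suc (sym (sum-replicate-zero k))
  ... | x ∷ʳ′ j = begin
      edges (x ∷ʳ j) []                             ≡⟨ edges-∷ʳ-[] x j ⟩
      δ x []                                        ≡⟨ δ-∷ʳ x [] j ⟨
      δ (x ∷ʳ j) (j ∷ [])                           ≡⟨ ∑-δ _ j (λ i i≢j → δ-∷ʳ-≢ x [] (i≢j ∘ sym)) ⟨
      ∑[ i < k ] δ (x ∷ʳ j) (i ∷ [])                ≡⟨ cong (_+ ∑[ i < k ] δ (x ∷ʳ j) (i ∷ [])) (δ-∷ʳ-[] x j) ⟨
      δ (x ∷ʳ j) [] + ∑[ i < k ] δ (x ∷ʳ j) (i ∷ []) ∎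
    where open ≡-Reasoning

  inflow-root : ∀ L → inflow L [] ≡ count L [] + ∑[ i < k ] count L (i ∷ [])
  inflow-root L = trans (sumOver-cong L edges-into-root)
                 (trans (sumOver-+ _ _ L) (cong (count L [] +_) (sumOver-∑ (λ v i → δ v (i ∷ [])) L)))

  below : Fin k → Vertex k → Maybe (Vertex k)
  below i v with initLast v
  ... | []      = nothing
  ... | w ∷ʳ′ j with j Finₚ.≟ i
  ...   | yes _ = just w
  ...   | no  _ = nothing

  δ-below : ∀ i v w → δ v (w ∷ʳ i) ≡ maybe′ (λ x → δ x w) 0 (below i v)
  δ-below i v w with initLast v
  ... | []      = δ-[]-∷ʳ w i
  ... | x ∷ʳ′ j with j Finₚ.≟ i
  ...   | yes refl = δ-∷ʳ x w j
  ...   | no  j≢i  = δ-∷ʳ-≢ x w j≢i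

  edges-below : ∀ i v w → edges v (w ∷ʳ i) + δ w [] * δ v (i ∷ [])
                          ≡ maybe′ (λ x → edges x w) 0 (below i v) + δ w [] * δ v []
  edges-below i v w with initLast v
  ... | []      = begin
      edges [] (w ∷ʳ i) + δ w [] * 0  ≡⟨ cong₂ _+_ (edges-[]-∷ʳ w i) (*-zeroʳ (δ w [])) ⟩
      δ w [] + 0                      ≡⟨ +-identityʳ _ ⟩
      δ w []                          ≡⟨ *-identityʳ _ ⟨
      δ w [] * 1                      ∎
    where open ≡-Reasoning
  ... | x ∷ʳ′ j with j Finₚ.≟ i
  ...   | yes refl = begin
      edges (x ∷ʳ j) (w ∷ʳ j) + δ w [] * δ (x ∷ʳ j) ([] ∷ʳ j)  ≡⟨ cong (λ d → edges (x ∷ʳ j) (w ∷ʳ j) + δ w [] * d) (δ-∷ʳ x [] j) ⟩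
      edges (x ∷ʳ j) (w ∷ʳ j) + δ w [] * δ x []               ≡⟨ edges-∷ʳ-∷ʳ x w j ⟩
      edges x w                                              ≡⟨ +-identityʳ _ ⟨
      edges x w + 0                                          ≡⟨ cong (edges x w +_) (trans (cong (δ w [] *_) (δ-∷ʳ-[] x j)) (*-zeroʳ (δ w []))) ⟨
      edges x w + δ w [] * δ (x ∷ʳ j) []                     ∎
    where open ≡-Reasoning
  ...   | no  j≢i  = cong₂ (λ e d → e + δ w [] * d) (edges-∷ʳ-≢ x w j≢i)
                           (trans (δ-∷ʳ-≢ x [] j≢i) (sym (δ-∷ʳ-[] x j)))

  restrict : Fin k → List (Vertex k) → List (Vertex k)
  restrict i = mapMaybe (below i)

  count-restrict : ∀ i L w → count (restrict i L) w ≡ count L (w ∷ʳ i)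
  count-restrict i L w = trans (sumOver-mapMaybe _ (below i) L) (sumOver-cong L (λ v → sym (δ-below i v w)))

  inflow-restrict : ∀ i L w → inflow L (w ∷ʳ i) + δ w [] * count L (i ∷ [])
                              ≡ inflow (restrict i L) w + δ w [] * count L []
  inflow-restrict i L w = begin
      inflow L (w ∷ʳ i) + δ w [] * count L (i ∷ [])
        ≡⟨ sumOver-linear _ (δ w []) _ L ⟨
      sumOver (λ v → edges v (w ∷ʳ i) + δ w [] * δ v (i ∷ [])) L
        ≡⟨ sumOver-cong L (λ v → edges-below i v w) ⟩
      sumOver (λ v → maybe′ (λ x → edges x w) 0 (below i v) + δ w [] * δ v []) L
        ≡⟨ sumOver-linear _ (δ w []) _ L ⟩
      sumOver (maybe′ (λ x → edges x w) 0 ∘ below i) L + δ w [] * count L []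
        ≡⟨ cong (_+ δ w [] * count L []) (sumOver-mapMaybe _ (below i) L) ⟨
      inflow (restrict i L) w + δ w [] * count L [] ∎
    where open ≡-Reasoning

  lift : ℕ → List (Vertex k) → List (Vertex k)
  lift a ws = replicate a [] ++ concatMap (λ i → map (_∷ʳ i) ws) (allFin k)

  sumOver-lift : ∀ (f : Vertex k → ℕ) a ws →
                 sumOver f (lift a ws) ≡ a * f [] + ∑[ i < k ] sumOver (λ v → f (v ∷ʳ i)) ws
  sumOver-lift f a ws = begin
      sumOver f (lift a ws)
        ≡⟨ sumOver-++ f (replicate a []) _ ⟩
      sumOver f (replicate a []) + sumOver f (concatMap (λ i → map (_∷ʳ i) ws) (allFin k))
        ≡⟨ cong₂ _+_ (sumOver-replicate f a []) (sumOver-concatMap f _ (allFin k)) ⟩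
      a * f [] + sumOver (λ i → sumOver f (map (_∷ʳ i) ws)) (allFin k)
        ≡⟨ cong (a * f [] +_) (sumOver-tabulate (λ i → sumOver f (map (_∷ʳ i) ws)) (λ i → i)) ⟩
      a * f [] + ∑[ i < k ] sumOver f (map (_∷ʳ i) ws)
        ≡⟨ cong (a * f [] +_) (sum-cong-≗ (λ i → sumOver-map f (_∷ʳ i) ws)) ⟩
      a * f [] + ∑[ i < k ] sumOver (λ v → f (v ∷ʳ i)) ws ∎
    where open ≡-Reasoning

  count-lift-[] : ∀ a ws → count (lift a ws) [] ≡ a
  count-lift-[] a ws = begin
      count (lift a ws) []                                   ≡⟨ sumOver-lift _ a ws ⟩
      a * 1 + ∑[ i < k ] sumOver (λ v → δ (v ∷ʳ i) []) ws    ≡⟨ cong₂ _+_ (*-identityʳ a) ∑≡0 ⟩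
      a + 0                                                  ≡⟨ +-identityʳ a ⟩
      a                                                      ∎
    where
      open ≡-Reasoning
      ∑≡0 = trans (sum-cong-≗ (λ i → sumOver-zero ws (λ v → δ-∷ʳ-[] v i))) (sum-replicate-zero k)

  count-lift-∷ʳ : ∀ a ws w j → count (lift a ws) (w ∷ʳ j) ≡ count ws w
  count-lift-∷ʳ a ws w j = begin
      count (lift a ws) (w ∷ʳ j)                                       ≡⟨ sumOver-lift _ a ws ⟩
      a * δ [] (w ∷ʳ j) + ∑[ i < k ] sumOver (λ v → δ (v ∷ʳ i) (w ∷ʳ j)) ws
        ≡⟨ cong₂ _+_ (trans (cong (a *_) (δ-[]-∷ʳ w j)) (*-zeroʳ a))
                     (∑-δ _ j (λ i i≢j → sumOver-zero ws (λ v → δ-∷ʳ-≢ v w i≢j))) ⟩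
      sumOver (λ v → δ (v ∷ʳ j) (w ∷ʳ j)) ws                          ≡⟨ sumOver-cong ws (λ v → δ-∷ʳ v w j) ⟩
      count ws w                                                       ∎
    where open ≡-Reasoning

  inflow-lift-[] : ∀ a ws → inflow (lift a ws) [] ≡ a + k * count ws []
  inflow-lift-[] a ws = begin
      inflow (lift a ws) []                                      ≡⟨ sumOver-lift _ a ws ⟩
      a * 1 + ∑[ i < k ] sumOver (λ v → edges (v ∷ʳ i) []) ws    ≡⟨ cong₂ _+_ (*-identityʳ a) ∑≡k*count ⟩
      a + k * count ws []                                        ∎
    where
      open ≡-Reasoning
      ∑≡k*count = trans (sum-cong-≗ (λ i → sumOver-cong ws (λ v → edges-∷ʳ-[] v i))) (∑-const k _)

  inflow-lift-∷ʳ : ∀ a ws w j → inflow (lift a ws) (w ∷ʳ j) + δ w [] * count ws []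
                                ≡ a * δ w [] + inflow ws w
  inflow-lift-∷ʳ a ws w j = begin
      inflow (lift a ws) (w ∷ʳ j) + δ w [] * count ws []
        ≡⟨ cong (_+ δ w [] * count ws []) (sumOver-lift _ a ws) ⟩
      a * edges [] (w ∷ʳ j) + ∑[ i < k ] sumOver (λ v → edges (v ∷ʳ i) (w ∷ʳ j)) ws + δ w [] * count ws []
        ≡⟨ cong (_+ δ w [] * count ws []) (cong₂ _+_ (cong (a *_) (edges-[]-∷ʳ w j)) ∑≡subtree-j) ⟩
      a * δ w [] + sumOver (λ v → edges (v ∷ʳ j) (w ∷ʳ j)) ws + δ w [] * count ws []
        ≡⟨ +-assoc (a * δ w []) _ _ ⟩
      a * δ w [] + (sumOver (λ v → edges (v ∷ʳ j) (w ∷ʳ j)) ws + δ w [] * count ws [])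
        ≡⟨ cong (a * δ w [] +_) (sumOver-linear _ (δ w []) _ ws) ⟨
      a * δ w [] + sumOver (λ v → edges (v ∷ʳ j) (w ∷ʳ j) + δ w [] * δ v []) ws
        ≡⟨ cong (a * δ w [] +_) (sumOver-cong ws (λ v → edges-∷ʳ-∷ʳ v w j)) ⟩
      a * δ w [] + inflow ws w ∎
    where
      open ≡-Reasoning
      ∑≡subtree-j = ∑-δ _ j (λ i i≢j → sumOver-zero ws (λ v → edges-∷ʳ-≢ v w i≢j))

  length-lift : ∀ a ws → length (lift a ws) ≡ a + k * length ws
  length-lift a ws = begin
      length (lift a ws)                           ≡⟨ sumOver-1≡length (lift a ws) ⟨
      sumOver (λ _ → 1) (lift a ws)                ≡⟨ sumOver-lift _ a ws ⟩
      a * 1 + ∑[ i < k ] sumOver (λ _ → 1) ws      ≡⟨ cong₂ _+_ (*-identityʳ a) (∑-const k _) ⟩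
      a + k * sumOver (λ _ → 1) ws                 ≡⟨ cong (λ n → a + k * n) (sumOver-1≡length ws) ⟩
      a + k * length ws                            ∎
    where open ≡-Reasoning

  lift-Stabilizes : ∀ {N M} ws → N ≤ k + k * M → Stabilizes (initial k M) ws →
                    Stabilizes (initial k N) (lift (M + count ws []) ws)
  lift-Stabilizes {N} {M} ws N≤k+kM ws-stab w with initLast w
  ... | [] = begin
      N + inflow (lift a ws) []            ≡⟨ cong (N +_) (inflow-lift-[] a ws) ⟩
      N + (M + m + k * m)                  ≤⟨ +-monoˡ-≤ _ N≤k+kM ⟩
      k + k * M + (M + m + k * m)          ≡⟨ regroup k M m ⟩
      k + suc k * a                        ≡⟨ cong (λ n → k + suc k * n) (count-lift-[] a ws) ⟨
      k + suc k * count (lift a ws) []     ∎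
    where
      open ≤-Reasoning
      m = count ws []
      a = M + m
      regroup : ∀ k M m → k + k * M + (M + m + k * m) ≡ k + suc k * (M + m)
      regroup = solve-∀
  ... | x ∷ʳ′ j = +-cancelʳ-≤ (d * m) _ _ (begin
      initial k N (x ∷ʳ j) + inflow (lift a ws) (x ∷ʳ j) + d * m
        ≡⟨ cong (λ c → c + inflow (lift a ws) (x ∷ʳ j) + d * m) root-only ⟩
      inflow (lift a ws) (x ∷ʳ j) + d * m
        ≡⟨ inflow-lift-∷ʳ a ws x j ⟩
      a * d + inflow ws x
        ≡⟨ regroup M m d (inflow ws x) ⟩
      d * M + inflow ws x + d * m
        ≡⟨ cong (λ c → c + inflow ws x + d * m) (initial≡δ* M x) ⟨
      initial k M x + inflow ws x + d * m
        ≤⟨ +-monoˡ-≤ (d * m) (ws-stab x) ⟩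
      k + suc k * count ws x + d * m
        ≡⟨ cong (λ n → k + suc k * n + d * m) (count-lift-∷ʳ a ws x j) ⟨
      k + suc k * count (lift a ws) (x ∷ʳ j) + d * m ∎)
    where
      open ≤-Reasoning
      m = count ws []
      a = M + m
      d = δ x []
      root-only : initial k N (x ∷ʳ j) ≡ 0
      root-only = trans (initial≡δ* N (x ∷ʳ j)) (cong (_* N) (δ-∷ʳ-[] x j))
      regroup : ∀ M m d i → (M + m) * d + i ≡ d * M + i + d * m
      regroup = solve-∀

  restrict-Stabilizes : ∀ {N M} vs i → Stabilizes (initial k N) vs →
                        M + count vs (i ∷ []) ≤ count vs [] →
                        Stabilizes (initial k M) (restrict i vs)
  restrict-Stabilizes {N} {M} vs i vs-stab few w = +-cancelʳ-≤ (d * u₀) _ _ (begin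
      initial k M w + inflow (restrict i vs) w + d * u₀
        ≡⟨ cong (λ c → c + inflow (restrict i vs) w + d * u₀) (initial≡δ* M w) ⟩
      d * M + inflow (restrict i vs) w + d * u₀
        ≡⟨ +-assoc (d * M) _ _ ⟩
      d * M + (inflow (restrict i vs) w + d * u₀)
        ≡⟨ cong (d * M +_) (inflow-restrict i vs w) ⟨
      d * M + (inflow vs (w ∷ʳ i) + d * uᵢ)
        ≤⟨ +-monoʳ-≤ (d * M) (+-monoˡ-≤ (d * uᵢ) (≤-trans (m≤n+m _ _) (vs-stab (w ∷ʳ i)))) ⟩
      d * M + (k + suc k * count vs (w ∷ʳ i) + d * uᵢ)
        ≡⟨ regroup d M (k + suc k * count vs (w ∷ʳ i)) uᵢ ⟩
      k + suc k * count vs (w ∷ʳ i) + d * (M + uᵢ)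
        ≤⟨ +-monoʳ-≤ (k + suc k * count vs (w ∷ʳ i)) (*-monoʳ-≤ d few) ⟩
      k + suc k * count vs (w ∷ʳ i) + d * u₀
        ≡⟨ cong (λ n → k + suc k * n + d * u₀) (count-restrict i vs w) ⟨
      k + suc k * count (restrict i vs) w + d * u₀ ∎)
    where
      open ≤-Reasoning
      d = δ w []
      u₀ = count vs []
      uᵢ = count vs (i ∷ [])
      regroup : ∀ d M s u → d * M + (s + d * u) ≡ s + d * (M + u)
      regroup = solve-∀

  root-balance : ∀ {N} vs → Stabilizes (initial k N) vs →
                 N + ∑[ i < k ] count vs (i ∷ []) ≤ k + k * count vs []
  root-balance {N} vs vs-stab = +-cancelʳ-≤ u₀ _ _ (begin
      N + ∑u + u₀         ≡⟨ +-assoc N ∑u u₀ ⟩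
      N + (∑u + u₀)       ≡⟨ cong (N +_) (trans (+-comm ∑u u₀) (sym (inflow-root vs))) ⟩
      N + inflow vs []    ≤⟨ vs-stab [] ⟩
      k + suc k * u₀      ≡⟨ x∙yz≈xz∙y k u₀ (k * u₀) ⟩
      k + k * u₀ + u₀     ∎)
    where
      open ≤-Reasoning
      u₀ = count vs []
      ∑u = ∑[ i < k ] count vs (i ∷ [])

  child-with-few-fires : ∀ {N M} vs → k * M < N → Stabilizes (initial k N) vs →
                         ∃ λ i → M + count vs (i ∷ []) ≤ count vs []
  child-with-few-fires {N} {M} vs kM<N vs-stab =
    map₂ ≤-pred (∑-<⇒∃-< (λ i → M + count vs (i ∷ [])) (λ _ → suc u₀) ∑<)
    where
      open ≤-Reasoning
      u₀ = count vs []
      ∑u = ∑[ i < k ] count vs (i ∷ [])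
      ∑< : ∑[ i < k ] (M + count vs (i ∷ [])) < ∑[ i < k ] suc u₀
      ∑< = begin-strict
        ∑[ i < k ] (M + count vs (i ∷ []))  ≡⟨ ∑-distrib-+ (λ _ → M) (λ i → count vs (i ∷ [])) ⟩
        ∑[ i < k ] M + ∑u                   ≡⟨ cong (_+ ∑u) (∑-const k M) ⟩
        k * M + ∑u                          <⟨ +-monoˡ-< ∑u kM<N ⟩
        N + ∑u                              ≤⟨ root-balance vs vs-stab ⟩
        k + k * u₀                          ≡⟨ *-suc k u₀ ⟨
        k * suc u₀                          ≡⟨ ∑-const k (suc u₀) ⟨
        ∑[ i < k ] suc u₀                   ∎

  stabilizing-length-recursion : ∀ {N M vs ws} → k * M < N → N ≤ k + k * M →
                       Stabilizing k N vs → Stabilizing k M ws →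
                       length vs ≡ rootFires vs + k * length ws
  stabilizing-length-recursion {N} {M} {vs} {ws} kM<N N≤k+kM (_ , vs-run , vs-stable) (_ , ws-run , ws-stable) =
    begin
      length vs                      ≡⟨ count-≗⇒length-≡ vs (lift u₀ ws) same-counts ⟩
      length (lift u₀ ws)            ≡⟨ length-lift u₀ ws ⟩
      u₀ + k * length ws             ≡⟨ cong (_+ k * length ws) (rootFires≡count vs) ⟨
      rootFires vs + k * length ws   ∎
    where
      open ≡-Reasoning
      vs-stab = stable-run⇒Stabilizes vs-run vs-stable
      ws-stab = stable-run⇒Stabilizes ws-run ws-stable
      u₀ = count vs []
      u : Fin k → ℕ
      u i = count vs (i ∷ [])

      at-most-ws : ∀ i w → count vs (w ∷ʳ i) ≤ count ws w
      at-most-ws i w = ≤-trans (least-action vs-run (lift (M + count ws []) ws) (lift-Stabilizes ws N≤k+kM ws-stab) (w ∷ʳ i))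
                               (≤-reflexive (count-lift-∷ʳ (M + count ws []) ws w i))

      at-least-ws : ∀ i → M + u i ≤ u₀ → ∀ w → count ws w ≤ count vs (w ∷ʳ i)
      at-least-ws i few w = ≤-trans (least-action ws-run (restrict i vs) (restrict-Stabilizes vs i vs-stab few) w)
                                    (≤-reflexive (count-restrict i vs w))

      every-child-few : ∀ i → M + u i ≤ u₀
      every-child-few i =
        let (i₀ , few₀) = child-with-few-fires vs kM<N vs-stab
        in ≤-trans (+-monoʳ-≤ M (≤-trans (at-most-ws i []) (at-least-ws i₀ few₀ []))) few₀

      same-counts : ∀ w → count vs w ≡ count (lift u₀ ws) w
      same-counts w with initLast w
      ... | []      = sym (count-lift-[] u₀ ws)
      ... | x ∷ʳ′ i = trans (≤-antisym (at-most-ws i x) (at-least-ws i (every-child-few i) x))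
                            (sym (count-lift-∷ʳ u₀ ws x i))

ceilDiv∸1-bounds : ∀ j N → 1 ≤ N →
  suc j * (ceilDiv N (suc j) ∸ 1) < N × N ≤ suc j + suc j * (ceilDiv N (suc j) ∸ 1)
ceilDiv∸1-bounds j N 1≤N =
  bounds ((N + j) / suc j) ((N + j) % suc j) (m≡m%n+[m/n]*n (N + j) (suc j)) (m%n<n (N + j) (suc j))
  where
    bounds : ∀ q r → N + j ≡ r + q * suc j → r < suc j →
             suc j * (q ∸ 1) < N × N ≤ suc j + suc j * (q ∸ 1)
    bounds zero    r N+j≡r r<1+j =
      contradiction (≤-trans (+-monoˡ-≤ j 1≤N) (≤-reflexive (trans N+j≡r (+-identityʳ r)))) (<⇒≱ r<1+j)
    bounds (suc M) r N+j≡ r<1+j =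
      subst (λ n → suc j * M < n × n ≤ suc j + suc j * M) (sym N≡)
        ( s≤s (≤-trans (≤-reflexive (*-comm (suc j) M)) (m≤n+m (M * suc j) r))
        , s≤s (+-mono-≤ (≤-pred r<1+j) (≤-reflexive (*-comm M (suc j)))))
      where
        shift : ∀ r M j → suc (r + M * suc j) + j ≡ r + suc M * suc j
        shift = solve-∀
        N≡ : N ≡ suc (r + M * suc j)
        N≡ = +-cancelʳ-≡ j _ _ (trans N+j≡ (sym (shift r M j)))

-- The argument works for every k ≥ 1; the hypothesis 2 ≤ k only excludes k = 0.
mainTheorem11 : (k : ℕ) → 2 ≤ k → (N : ℕ) → 1 ≤ N →
    (vs : List (Vertex k)) → Stabilizing k N vs →
    (ws : List (Vertex k)) → Stabilizing k (ceilDiv N k ∸ 1) ws →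
    length vs ≡ rootFires vs + k * length ws
mainTheorem11 zero    ()
mainTheorem11 (suc j) _  N 1≤N vs vs-stabilizing ws ws-stabilizing =
  let (kM<N , N≤k+kM) = ceilDiv∸1-bounds j N 1≤N
  in stabilizing-length-recursion kM<N N≤k+kM vs-stabilizing ws-stabilizing
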